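{- Let $p$ be a prime, $d\geq 2$ with $d\mid p-1$, $A,C\in\mathbb{F}_p$ with $A\neq 0$, $f(X)=AX^d+C$, $\gamma\in\mathbb{F}_p$ a fixed primitive $d$-th root of unity, and $k\geq 1$, $r\geq -1$. Let $G$ be a complete proper $(r,k,d)$-graph and let $G_0$ be an $(r,k,d)$-tree which generates $G$. Then $\mathcal{C}_G=\mathcal{C}_{G_0}$.
   Context: Iterates: $f^{\circ 0}(X)=X$, $f^{\circ(j+1)}=f\circ f^{\circ j}$. An $(r,k,d)$-graph is a graph $G$ with vertex set $\{1,\dots,k\}$ together with, for each edge $\overline{ab}$, values $\xi_G(a,b),\xi_G(b,a)\in\{ -1,\dots,r\}$ and $\eta_G(a,b),\eta_G(b,a)\in\{0,\dots,d-1\}$ such that $\xi_G(a,b)=\xi_G(b,a)$, $\eta_G(a,b)+\eta_G(b,a)\equiv 0\pmod d$, $\eta=0$ when $\xi=-1$, and $\eta\in\{1,\dots,d-1\}$ when $\xi\geq 0$. Complete: every pair of distinct vertices is joined. Proper: for all distinct vertices $a,b,c$ with $\overline{ab},\overline{ac},\overline{bc}$ edges: (1) if $\xi_G(a,b)=\xi_G(b,c)=-1$ then $\xi_G(a,c)=-1$; (2) if $\xi_G(a,b)<\xi_G(b,c)$ then $\xi_G(a,c)=\xi_G(b,c)$ and $\eta_G(a,c)=\eta_G(b,c)$; (3) if $0\leq\xi_G(a,b)=\xi_G(b,c)$ and $\eta_G(a,b)+\eta_G(b,c)\neq d$ then $\xi_G(a,c)=\xi_G(a,b)$ and $\eta_G(a,c)\equiv\eta_G(a,b)+\eta_G(b,c)\pmod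 d$; (4) if $0\leq\xi_G(a,b)=\xi_G(b,c)$ and $\eta_G(a,b)+\eta_G(b,c)=d$ then $\xi_G(a,c)<\xi_G(a,b)$. A chain of edges $\overline{a_0a_1},\dots,\overline{a_{s-1}a_s}$ with pairwise distinct vertices is potentially complete in $G$ if there is $0\leq u\leq s-1$ with (a) $\xi_G(a_0,a_1)\leq\dots\leq\xi_G(a_u,a_{u+1})\geq\dots\geq\xi_G(a_{s-1},a_s)$ with no two consecutive equalities in this chain of inequalities, and (b) whenever $\xi_G(a_{i-1},a_i)=\xi_G(a_i,a_{i+1})\geq 0$, $\eta_G(a_{i-1},a_i)+\eta_G(a_i,a_{i+1})\not\equiv 0\pmod d$. An $(r,k,d)$-tree is a proper $(r,k,d)$-graph containing no cycle such that any two vertices are joined by a unique chain and this chain is potentially complete. One-step generation: if $G_0$ is a proper $(r,k,d)$-graph with distinct vertices $a,b,c$ such that $\overline{ab},\overline{bc}$ are edges but $\overline{ac}$ is not, and either (i) $\xi_{G_0}(a,b)=\xi_{G_0}(b,c)=-1$, or (ii) $0\leq\xi_{G_0}(a,b)=\xi_{G_0}(b,c)$ and $\eta_{G_0}(a,b)+\eta_{G_0}(b,c)\neq d$, or (iii) $-1\leq\xi_{G_0}(a,b)<\xi_{G_0}(b,c)$, let $G$ be obtained by adding the edge $\overline{ac}$ with, respectively, (i') $\xi_G(a,c)=-1,\eta_G(a,c)=0$; (ii') $\xi_G(a,c)=\xi_{G_0}(a,b)$ and $\eta_G(a,c)\in\{1,\dots,d-1\}$ congruent to $\eta_{G_0}(a,b)+\eta_{G_0}(b,c)$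 mod $d$; (iii') $\xi_G(a,c)=\xi_{G_0}(b,c)$, $\eta_G(a,c)=\eta_{G_0}(b,c)$. If this $G$ is proper, $G_0$ generates $G$. In general $G_0$ generates $G$ if there is a chain $G_0,\dots,G_s=G$ of proper graphs each obtained from the previous by one-step generation. $\Phi(X,Y,Z;-1,0)=X-Y$ and, for $\ell\geq 0$, $1\leq h\leq d-1$, $\Phi(X,Y,Z;\ell,h)=Z^{d^\ell}\big(f^{\circ\ell}(X/Z)-\gamma^h f^{\circ\ell}(Y/Z)\big)$. For an $(r,k,d)$-graph $G$, $\mathcal{C}_G\subset\mathbb{P}^k$ (coordinates $(X_0:\dots:X_k)$) is defined by $\Phi(X_a,X_b,X_0;\xi_G(a,b),\eta_G(a,b))=0$ for all edges $\overline{ab}$ of $G$. -}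

module Defs where

open import Level using (Level; _⊔_)
open import Data.Nat as ℕ using (ℕ; zero; suc)
open import Data.Nat.Divisibility using (_∣_)
open import Data.Integer as ℤ using (ℤ; +_; -[1+_])
open import Data.Bool using (Bool; true; false)
open import Data.Fin as Fin using (Fin)
open import Data.Product using (Σ; ∃; _×_; _,_)
open import Data.Sum using (_⊎_)
open import Data.Empty using (⊥)
open import Relation.Nullary using (¬_)
open import Relation.Binary.PropositionalEquality using (_≡_)
open import Relation.Binary.Construct.Closure.ReflexiveTransitive using (Star)
open import Algebra.Bundles using (CommutativeRing)

IsField : ∀ {c ℓ} → CommutativeRing c ℓ → Set (c ⊔ ℓ)
IsField R = ¬ (1# ≈ 0#) × (∀ x → ¬ (x ≈ 0#) → ∃ λ y → x * y ≈ 1#)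
  where open CommutativeRing R

module FieldOps {c ℓ} (K : CommutativeRing c ℓ) where
  open CommutativeRing K

  -- the canonical map ℕ → K, n ↦ n·1 (its image is the prime field)
  ι : ℕ → Carrier
  ι zero    = 0#
  ι (suc n) = 1# + ι n

  infixr 8 _^_
  _^_ : Carrier → ℕ → Carrier
  x ^ zero  = 1#
  x ^ suc n = x * (x ^ n)

  -- Homogenised iterates of f(X) = A X^d + C:
  --   Fh ℓ X Z = Z^(d^ℓ) · f^{∘ℓ}(X/Z)
  -- Fh 0 X Z = X,  Fh (ℓ+1) X Z = A·(Fh ℓ X Z)^d + C·Z^(d^(ℓ+1)).
  Fh : (A C : Carrier) (d : ℕ) → ℕ → Carrier → Carrier → Carrier
  Fh A C d zero    X Z = X
  Fh A C d (suc l) X Z = A * (Fh A C d l X Z ^ d) + C * (Z ^ (d ℕ.^ suc l))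

  -- Φ(X,Y,Z; ξ, η); ξ = -1 gives X - Y, ξ = ℓ ≥ 0 gives
  -- Z^(d^ℓ) (f^{∘ℓ}(X/Z) - γ^η f^{∘ℓ}(Y/Z)).
  Φ : (A C γ : Carrier) (d : ℕ) → Carrier → Carrier → Carrier → ℤ → ℕ → Carrier
  Φ A C γ d X Y Z -[1+ _ ] h = X - Y
  Φ A C γ d X Y Z (+ l)    h = Fh A C d l X Z - (γ ^ h) * Fh A C d l Y Z

-- Labelled graphs on vertex set Fin k (vertex i ↔ paper's vertex i+1).
-- adj u v = true iff ū v̄ is an edge; ξ, η only matter on edges.

record Graph (k : ℕ) : Set where
  field
    adj : Fin k → Fin k → Bool
    ξ   : Fin k → Fin k → ℤ
    η   : Fin k → Fin k → ℕ
open Graph public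

Edge : ∀ {k} → Graph k → Fin k → Fin k → Set
Edge G u v = adj G u v ≡ true

CongMod : ℕ → ℕ → ℕ → Set
CongMod m n d = ∃ λ q → ∃ λ q′ → m ℕ.+ q ℕ.* d ≡ n ℕ.+ q′ ℕ.* d

-1ℤ : ℤ
-1ℤ = -[1+ 0 ]

record IsRKD (r : ℤ) (k d : ℕ) (G : Graph k) : Set where
  field
    irrefl  : ∀ u → ¬ Edge G u u
    sym     : ∀ u v → Edge G u v → Edge G v u
    ξ-sym   : ∀ u v → Edge G u v → ξ G u v ≡ ξ G v u
    η-sum   : ∀ u v → Edge G u v → d ∣ (η G u v ℕ.+ η G v u)
    ξ-range : ∀ u v → Edge G u v → (-1ℤ ℤ.≤ ξ G u v) × (ξ G u v ℤ.≤ r)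
    η-range : ∀ u v → Edge G u v → η G u v ℕ.< d
    η-neg   : ∀ u v → Edge G u v → ξ G u v ≡ -1ℤ → η G u v ≡ 0
    η-pos   : ∀ u v → Edge G u v → + 0 ℤ.≤ ξ G u v → 1 ℕ.≤ η G u v

Complete : ∀ {k} → Graph k → Set
Complete G = ∀ u v → ¬ u ≡ v → Edge G u v

record IsProper (d : ℕ) {k} (G : Graph k) : Set where
  field
    prop1 : ∀ a b c → ¬ a ≡ b → ¬ a ≡ c → ¬ b ≡ c →
            Edge G a b → Edge G a c → Edge G b c →
            ξ G a b ≡ -1ℤ → ξ G b c ≡ -1ℤ → ξ G a c ≡ -1ℤ
    prop2 : ∀ a b c → ¬ a ≡ b → ¬ a ≡ c → ¬ b ≡ c →
            Edge G a b → Edge G a c → Edge G b c →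
            ξ G a b ℤ.< ξ G b c → (ξ G a c ≡ ξ G b c) × (η G a c ≡ η G b c)
    prop3 : ∀ a b c → ¬ a ≡ b → ¬ a ≡ c → ¬ b ≡ c →
            Edge G a b → Edge G a c → Edge G b c →
            + 0 ℤ.≤ ξ G a b → ξ G a b ≡ ξ G b c → ¬ (η G a b ℕ.+ η G b c ≡ d) →
            (ξ G a c ≡ ξ G a b) × CongMod (η G a c) (η G a b ℕ.+ η G b c) d
    prop4 : ∀ a b c → ¬ a ≡ b → ¬ a ≡ c → ¬ b ≡ c →
            Edge G a b → Edge G a c → Edge G b c →
            + 0 ℤ.≤ ξ G a b → ξ G a b ≡ ξ G b c → η G a b ℕ.+ η G b c ≡ d →
            ξ G a c ℤ.< ξ G a b

record IsChain {k} (G : Graph k) (s : ℕ) (v : ℕ → Fin k) : Set where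
  field
    len≥1    : 1 ℕ.≤ s
    distinct : ∀ i j → i ℕ.≤ s → j ℕ.≤ s → v i ≡ v j → i ≡ j
    adjacent : ∀ i → i ℕ.< s → Edge G (v i) (v (suc i))

HasCycle : ∀ {k} → Graph k → Set
HasCycle G = Σ ℕ λ s → Σ (ℕ → Fin _) λ v →
  IsChain G s v × 2 ℕ.≤ s × Edge G (v s) (v 0)

PotentiallyComplete : ∀ {k} (d : ℕ) (G : Graph k) (s : ℕ) (v : ℕ → Fin k) → Set
PotentiallyComplete d G s v =
  Σ ℕ λ u → u ℕ.< s ×
    (∀ i → suc i ℕ.≤ u → x i ℤ.≤ x (suc i)) ×
    (∀ i → u ℕ.≤ i → suc i ℕ.< s → x (suc i) ℤ.≤ x i) ×
    (∀ i → suc (suc i) ℕ.< s → ¬ (x i ≡ x (suc i) × x (suc i) ≡ x (suc (suc i)))) ×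
    (∀ i → suc i ℕ.< s → x i ≡ x (suc i) → + 0 ℤ.≤ x i →
       ¬ (d ∣ (e i ℕ.+ e (suc i))))
  where
    x : ℕ → ℤ
    x i = ξ G (v i) (v (suc i))
    e : ℕ → ℕ
    e i = η G (v i) (v (suc i))

record IsTree (r : ℤ) (k d : ℕ) (G : Graph k) : Set where
  field
    rkd      : IsRKD r k d G
    proper   : IsProper d G
    acyclic  : ¬ HasCycle G
    connect  : ∀ a b → ¬ a ≡ b →
               Σ ℕ λ s → Σ (ℕ → Fin k) λ v → IsChain G s v × v 0 ≡ a × v s ≡ b
    unique   : ∀ a b s v s′ v′ → IsChain G s v → v 0 ≡ a → v s ≡ b →
               IsChain G s′ v′ → v′ 0 ≡ a → v′ s′ ≡ b →
               (s ≡ s′) × (∀ i → i ℕ.≤ s → v i ≡ v′ i)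
    potcompl : ∀ s v → IsChain G s v → PotentiallyComplete d G s v

-- G is G₀ with the edge a c added, labelled ξ(a,c) = x, η(a,c) = e
-- (ξ(c,a), η(c,a) are then forced by G being an (r,k,d)-graph).
record AddEdge {k} (G₀ G : Graph k) (a c : Fin k) (x : ℤ) (e : ℕ) : Set where
  field
    adj-iff₁ : ∀ u v → Edge G u v → Edge G₀ u v ⊎ ((u ≡ a × v ≡ c) ⊎ (u ≡ c × v ≡ a))
    adj-iff₂ : ∀ u v → Edge G₀ u v ⊎ ((u ≡ a × v ≡ c) ⊎ (u ≡ c × v ≡ a)) → Edge G u v
    keep     : ∀ u v → Edge G₀ u v → (ξ G u v ≡ ξ G₀ u v) × (η G u v ≡ η G₀ u v)
    new-ξ    : ξ G a c ≡ x
    new-η    : η G a c ≡ e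

NewLabel : ∀ {k} (d : ℕ) (G₀ : Graph k) (a b c : Fin k) (x : ℤ) (e : ℕ) → Set
NewLabel d G₀ a b c x e =
    (ξ G₀ a b ≡ -1ℤ × ξ G₀ b c ≡ -1ℤ × x ≡ -1ℤ × e ≡ 0)
  ⊎ ((+ 0 ℤ.≤ ξ G₀ a b × ξ G₀ a b ≡ ξ G₀ b c × ¬ (η G₀ a b ℕ.+ η G₀ b c ≡ d))
       × x ≡ ξ G₀ a b × 1 ℕ.≤ e × e ℕ.< d × CongMod e (η G₀ a b ℕ.+ η G₀ b c) d)
  ⊎ (ξ G₀ a b ℤ.< ξ G₀ b c × x ≡ ξ G₀ b c × e ≡ η G₀ b c)

record OneStep (r : ℤ) (k d : ℕ) (G₀ G : Graph k) : Set where
  field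
    a b c   : Fin k
    ab      : ¬ a ≡ b
    ac      : ¬ a ≡ c
    bc      : ¬ b ≡ c
    e-ab    : Edge G₀ a b
    e-bc    : Edge G₀ b c
    ne-ac   : ¬ Edge G₀ a c
    x       : ℤ
    e       : ℕ
    label   : NewLabel d G₀ a b c x e
    added   : AddEdge G₀ G a c x e
    rkd     : IsRKD r k d G
    proper  : IsProper d G

Generates : (r : ℤ) (k d : ℕ) → Graph k → Graph k → Set
Generates r k d = Star (OneStep r k d)

-- The variety 𝒞_G, via its points in K^{k+1} (coordinates X₀,…,X_k;
-- vertex i : Fin k ↔ coordinate X (suc i)).

module _ {c ℓ} (K : CommutativeRing c ℓ) where
  open CommutativeRing K
  open FieldOps K

  OnCurve : (A C γ : Carrier) (d : ℕ) {k : ℕ} → Graph k → (Fin (suc k) → Carrier) → Set ℓ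
  OnCurve A C γ d G X =
    ∀ a b → Edge G a b →
      Φ A C γ d (X (Fin.suc a)) (X (Fin.suc b)) (X Fin.zero) (ξ G a b) (η G a b) ≈ 0#

-- Every one-step generation rule is an algebraic consequence of the equations of the
-- two edges it combines, and generation never changes the labels of existing edges,
-- so adding generated edges does not change the variety.  Writing F_ℓ for the
-- homogenised iterate, the edge equations read x = y (ξ = -1) and F_ℓ x = γ^h F_ℓ y
-- (ξ = ℓ ≥ 0).  Equations of the same level compose multiplicatively, since γ^h only
-- matters modulo d.  Raising F_ℓ x = γ^h F_ℓ y to the d-th power kills γ^h, so it
-- implies F_m x = F_m y for every m > ℓ; this absorbs an edge of lower level into one
-- of higher level.
module Submission where

open import Defs
open import Data.Nat using (ℕ; suc; _≤_; _∸_)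
open import Data.Nat.Divisibility using (_∣_)
open import Data.Nat.Primality using (Prime)
open import Data.Integer using (ℤ)
open import Data.Fin using (Fin)
open import Data.Product using (_×_)
open import Relation.Nullary using (¬_)
open import Algebra.Bundles using (CommutativeRing)

open import Data.Nat as ℕ using (zero; _≤′_; ≤′-refl; ≤′-step)
import Data.Nat.Properties as ℕₚ
open import Data.Nat.Divisibility using (divides)
open import Data.Integer as ℤ using (+_; -[1+_]; -<-; -<+; +<+)
open import Data.Product using (_,_)
open import Data.Sum using (_⊎_; inj₁; inj₂)
open import Function using (id; _∘_)
open import Relation.Binary.PropositionalEquality as ≡ using (_≡_; refl)
open import Relation.Binary.Construct.Closure.ReflexiveTransitive using (fold)
import Algebra.Properties.CommutativeSemiring.Exp as CommutativeSemiringExp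
import Algebra.Properties.Group as GroupProperties
import Relation.Binary.Reasoning.Setoid as SetoidReasoning

module Powers {c ℓ} (K : CommutativeRing c ℓ) where
  open CommutativeRing K renaming (refl to ≈-refl)
  open FieldOps K
  private module Exp = CommutativeSemiringExp commutativeSemiring

  ^≡Exp^ : ∀ x n → x ^ n ≡ x Exp.^ n
  ^≡Exp^ x zero    = refl
  ^≡Exp^ x (suc n) = ≡.cong (x *_) (^≡Exp^ x n)

  ^-congˡ : ∀ n {x y} → x ≈ y → x ^ n ≈ y ^ n
  ^-congˡ n {x} {y} rewrite ^≡Exp^ x n | ^≡Exp^ y n = Exp.^-congˡ n

  ^-homo-* : ∀ x m n → x ^ (m ℕ.+ n) ≈ x ^ m * x ^ n
  ^-homo-* x m n rewrite ^≡Exp^ x (m ℕ.+ n) | ^≡Exp^ x m | ^≡Exp^ x n = Exp.^-homo-* x m n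

  ^-assocʳ : ∀ x m n → (x ^ m) ^ n ≈ x ^ (m ℕ.* n)
  ^-assocʳ x m n
    rewrite ^≡Exp^ (x ^ m) n | ^≡Exp^ x m | ^≡Exp^ x (m ℕ.* n) = Exp.^-assocʳ x m n

  ^-distrib-* : ∀ x y n → (x * y) ^ n ≈ x ^ n * y ^ n
  ^-distrib-* x y n
    rewrite ^≡Exp^ (x * y) n | ^≡Exp^ x n | ^≡Exp^ y n = Exp.^-distrib-* x y n

  1^n≈1 : ∀ n → 1# ^ n ≈ 1#
  1^n≈1 zero    = ≈-refl
  1^n≈1 (suc n) = trans (*-identityˡ _) (1^n≈1 n)

  module RootOfUnity (γ : Carrier) (d : ℕ) (γᵈ≈1 : γ ^ d ≈ 1#) where
    open SetoidReasoning setoid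

    ^-multiple≈1 : ∀ {n} → d ∣ n → γ ^ n ≈ 1#
    ^-multiple≈1 (divides q refl) = begin
      γ ^ (q ℕ.* d)  ≡⟨ ≡.cong (γ ^_) (ℕₚ.*-comm q d) ⟩
      γ ^ (d ℕ.* q)  ≈⟨ ^-assocʳ γ d q ⟨
      (γ ^ d) ^ q    ≈⟨ ^-congˡ q γᵈ≈1 ⟩
      1# ^ q         ≈⟨ 1^n≈1 q ⟩
      1#             ∎

    ^-congMod : ∀ {m n} → CongMod m n d → γ ^ m ≈ γ ^ n
    ^-congMod {m} {n} (q , q′ , m+qd≡n+q′d) = begin
      γ ^ m                    ≈⟨ *-identityʳ _ ⟨
      γ ^ m * 1#               ≈⟨ *-congˡ (^-multiple≈1 (divides q refl)) ⟨
      γ ^ m * γ ^ (q ℕ.* d)    ≈⟨ ^-homo-* γ m (q ℕ.* d) ⟨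
      γ ^ (m ℕ.+ q ℕ.* d)      ≡⟨ ≡.cong (γ ^_) m+qd≡n+q′d ⟩
      γ ^ (n ℕ.+ q′ ℕ.* d)     ≈⟨ ^-homo-* γ n (q′ ℕ.* d) ⟩
      γ ^ n * γ ^ (q′ ℕ.* d)   ≈⟨ *-congˡ (^-multiple≈1 (divides q′ refl)) ⟩
      γ ^ n * 1#               ≈⟨ *-identityʳ _ ⟩
      γ ^ n                    ∎

    [γ^h]^d≈1 : ∀ h → (γ ^ h) ^ d ≈ 1#
    [γ^h]^d≈1 h = trans (^-assocʳ γ h d) (^-multiple≈1 (divides h refl))

-- NewLabel d G₀ a b c unfolds to this predicate at the labels of the edges ab and bc.
ComposableLabels : (d : ℕ) (i j : ℤ) (h₁ h₂ : ℕ) (x : ℤ) (e : ℕ) → Set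
ComposableLabels d i j h₁ h₂ x e =
    (i ≡ -1ℤ × j ≡ -1ℤ × x ≡ -1ℤ × e ≡ 0)
  ⊎ ((+ 0 ℤ.≤ i × i ≡ j × ¬ (h₁ ℕ.+ h₂ ≡ d))
       × x ≡ i × 1 ℕ.≤ e × e ℕ.< d × CongMod e (h₁ ℕ.+ h₂) d)
  ⊎ (i ℤ.< j × x ≡ j × e ≡ h₂)

Extends : ∀ {k} → Graph k → Graph k → Set
Extends G₀ G = ∀ u v → Edge G₀ u v → Edge G u v × ξ G u v ≡ ξ G₀ u v × η G u v ≡ η G₀ u v

Extends-refl : ∀ {k} {G : Graph k} → Extends G G
Extends-refl u v uv = uv , refl , refl

Extends-trans : ∀ {k} {G₀ G₁ G₂ : Graph k} → Extends G₀ G₁ → Extends G₁ G₂ → Extends G₀ G₂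
Extends-trans ext₀₁ ext₁₂ u v uv with ext₀₁ u v uv
... | uv₁ , ξ₁ , η₁ with ext₁₂ u v uv₁
...   | uv₂ , ξ₂ , η₂ = uv₂ , ≡.trans ξ₂ ξ₁ , ≡.trans η₂ η₁

OneStep⇒Extends : ∀ {r k d} {G₀ G : Graph k} → OneStep r k d G₀ G → Extends G₀ G
OneStep⇒Extends step u v uv = AddEdge.adj-iff₂ added u v (inj₁ uv) , AddEdge.keep added u v uv
  where open OneStep step

Generates⇒Extends : ∀ {r k d} {G₀ G : Graph k} → Generates r k d G₀ G → Extends G₀ G
Generates⇒Extends = fold Extends (Extends-trans ∘ OneStep⇒Extends) Extends-refl

module Varieties {c ℓ} (K : CommutativeRing c ℓ) where
  open CommutativeRing K hiding (refl)
  open FieldOps K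
  open Powers K
  open GroupProperties +-group using (x∙y⁻¹≈ε⇒x≈y; x≈y⇒x∙y⁻¹≈ε)
  open SetoidReasoning setoid

  module _ (A C γ : Carrier) (d : ℕ) (γᵈ≈1 : γ ^ d ≈ 1#) (Z : Carrier) where
    open RootOfUnity γ d γᵈ≈1

    F : ℕ → Carrier → Carrier
    F l x = Fh A C d l x Z

    ΦVanishes : Carrier → Carrier → ℤ → ℕ → Set ℓ
    ΦVanishes x y i h = Φ A C γ d x y Z i h ≈ 0#

    F-cong : ∀ l {x y} → x ≈ y → F l x ≈ F l y
    F-cong zero    x≈y = x≈y
    F-cong (suc l) x≈y = +-congʳ (*-congˡ (^-congˡ d (F-cong l x≈y)))

    F-suc-cong : ∀ l {x y} → F l x ^ d ≈ F l y ^ d → F (suc l) x ≈ F (suc l) y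
    F-suc-cong l eq = +-congʳ (*-congˡ eq)

    F-suc-cong-root : ∀ l h {x y} → F l x ≈ γ ^ h * F l y → F (suc l) x ≈ F (suc l) y
    F-suc-cong-root l h {x} {y} eq = F-suc-cong l (begin
      F l x ^ d                ≈⟨ ^-congˡ d eq ⟩
      (γ ^ h * F l y) ^ d      ≈⟨ ^-distrib-* (γ ^ h) (F l y) d ⟩
      (γ ^ h) ^ d * F l y ^ d  ≈⟨ *-congʳ ([γ^h]^d≈1 h) ⟩
      1# * F l y ^ d           ≈⟨ *-identityˡ _ ⟩
      F l y ^ d                ∎)

    F-mono-cong : ∀ {m l x y} → m ≤′ l → F m x ≈ F m y → F l x ≈ F l y
    F-mono-cong ≤′-refl          eq = eq
    F-mono-cong (≤′-step {l} m≤l) eq = F-suc-cong l (^-congˡ d (F-mono-cong m≤l eq))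

    γ^h*γ^h′ : ∀ h h′ u → γ ^ h * (γ ^ h′ * u) ≈ γ ^ (h ℕ.+ h′) * u
    γ^h*γ^h′ h h′ u = trans (sym (*-assoc _ _ _)) (*-congʳ (sym (^-homo-* γ h h′)))

    ΦVanishes-sym : ∀ {x y} i {h h′} → d ∣ h′ ℕ.+ h → ΦVanishes x y i h → ΦVanishes y x i h′
    ΦVanishes-sym {x} {y} -[1+ _ ] _ x-y≈0 = x≈y⇒x∙y⁻¹≈ε (sym (x∙y⁻¹≈ε⇒x≈y x y x-y≈0))
    ΦVanishes-sym {x} {y} (+ l) {h} {h′} d∣h′+h eq = x≈y⇒x∙y⁻¹≈ε (sym (begin
      γ ^ h′ * F l x            ≈⟨ *-congˡ (x∙y⁻¹≈ε⇒x≈y _ _ eq) ⟩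
      γ ^ h′ * (γ ^ h * F l y)  ≈⟨ γ^h*γ^h′ h′ h _ ⟩
      γ ^ (h′ ℕ.+ h) * F l y    ≈⟨ *-congʳ (^-multiple≈1 d∣h′+h) ⟩
      1# * F l y                ≈⟨ *-identityˡ _ ⟩
      F l y                     ∎))

    ΦVanishes-trans-equal : ∀ {x y z} m n o h₁ h₂ e →
      ΦVanishes x y -[1+ m ] h₁ → ΦVanishes y z -[1+ n ] h₂ → ΦVanishes x z -[1+ o ] e
    ΦVanishes-trans-equal {x} {y} {z} _ _ _ _ _ _ x-y≈0 y-z≈0 =
      x≈y⇒x∙y⁻¹≈ε (trans (x∙y⁻¹≈ε⇒x≈y x y x-y≈0) (x∙y⁻¹≈ε⇒x≈y y z y-z≈0))

    ΦVanishes-trans-level : ∀ {x y z} l {h₁ h₂ e} → CongMod e (h₁ ℕ.+ h₂) d →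
      ΦVanishes x y (+ l) h₁ → ΦVanishes y z (+ l) h₂ → ΦVanishes x z (+ l) e
    ΦVanishes-trans-level {x} {y} {z} l {h₁} {h₂} {e} e≡h₁+h₂ xy yz = x≈y⇒x∙y⁻¹≈ε (begin
      F l x                       ≈⟨ x∙y⁻¹≈ε⇒x≈y _ _ xy ⟩
      γ ^ h₁ * F l y              ≈⟨ *-congˡ (x∙y⁻¹≈ε⇒x≈y _ _ yz) ⟩
      γ ^ h₁ * (γ ^ h₂ * F l z)   ≈⟨ γ^h*γ^h′ h₁ h₂ _ ⟩
      γ ^ (h₁ ℕ.+ h₂) * F l z     ≈⟨ *-congʳ (^-congMod {e} {h₁ ℕ.+ h₂} e≡h₁+h₂) ⟨
      γ ^ e * F l z               ∎)

    ΦVanishes-trans-< : ∀ {x y z i j h₁ h₂} → i ℤ.< j →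
      ΦVanishes x y i h₁ → ΦVanishes y z j h₂ → ΦVanishes x z j h₂
    ΦVanishes-trans-< {i = -[1+ m ]} {j = -[1+ n ]} {h₁} {h₂} (-<- _) =
      ΦVanishes-trans-equal m n n h₁ h₂ h₂
    ΦVanishes-trans-< {x} {y} {j = + l} -<+ xy yz =
      x≈y⇒x∙y⁻¹≈ε (trans (F-cong l (x∙y⁻¹≈ε⇒x≈y x y xy)) (x∙y⁻¹≈ε⇒x≈y _ _ yz))
    ΦVanishes-trans-< {i = + m} {+ l} {h₁} (+<+ m<l) xy yz = x≈y⇒x∙y⁻¹≈ε (trans
      (F-mono-cong (ℕₚ.≤⇒≤′ m<l) (F-suc-cong-root m h₁ (x∙y⁻¹≈ε⇒x≈y _ _ xy)))
      (x∙y⁻¹≈ε⇒x≈y _ _ yz))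

    ΦVanishes-compose : ∀ {x y z i j h₁ h₂ i′ e} → ComposableLabels d i j h₁ h₂ i′ e →
      ΦVanishes x y i h₁ → ΦVanishes y z j h₂ → ΦVanishes x z i′ e
    ΦVanishes-compose {h₁ = h₁} {h₂} (inj₁ (refl , refl , refl , refl)) =
      ΦVanishes-trans-equal 0 0 0 h₁ h₂ 0
    ΦVanishes-compose {i = + l} {h₁ = h₁} {h₂}
      (inj₂ (inj₁ ((_ , refl , _) , refl , _ , _ , e≡h₁+h₂))) =
      ΦVanishes-trans-level l {h₁} {h₂} e≡h₁+h₂
    ΦVanishes-compose (inj₂ (inj₂ (i<j , refl , refl))) = ΦVanishes-trans-< i<j

  module _ (A C γ : Carrier) (d : ℕ) (γᵈ≈1 : γ ^ d ≈ 1#) {k : ℕ} (X : Fin (suc k) → Carrier) where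

    EdgeHolds : Fin k → Fin k → ℤ → ℕ → Set ℓ
    EdgeHolds u v = ΦVanishes A C γ d γᵈ≈1 (X Fin.zero) (X (Fin.suc u)) (X (Fin.suc v))

    relabel : ∀ {u v i i′ h h′} → i ≡ i′ → h ≡ h′ → EdgeHolds u v i h → EdgeHolds u v i′ h′
    relabel = ≡.subst₂ (EdgeHolds _ _)

    OnCurve-restrict : ∀ {G₀ G : Graph k} → Extends G₀ G →
      OnCurve K A C γ d G X → OnCurve K A C γ d G₀ X
    OnCurve-restrict ext onG u v uv with ext u v uv
    ... | uvᴳ , ξ≡ , η≡ = relabel ξ≡ η≡ (onG u v uvᴳ)

    module _ {r} {G₀ G : Graph k} (step : OneStep r k d G₀ G) (onG₀ : OnCurve K A C γ d G₀ X) where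
      private
        module S = OneStep step
        module N = AddEdge S.added
        module R = IsRKD S.rkd

      new-edge-holds : EdgeHolds S.a S.c S.x S.e
      new-edge-holds = ΦVanishes-compose A C γ d γᵈ≈1 (X Fin.zero) S.label
        (onG₀ S.a S.b S.e-ab) (onG₀ S.b S.c S.e-bc)

      OnCurve-oneStep : OnCurve K A C γ d G X
      OnCurve-oneStep u v uv with N.adj-iff₁ u v uv
      ... | inj₁ uv₀ with N.keep u v uv₀
      ...   | ξ≡ , η≡ = relabel (≡.sym ξ≡) (≡.sym η≡) (onG₀ u v uv₀)
      OnCurve-oneStep u v uv | inj₂ (inj₁ (refl , refl)) =
        relabel (≡.sym N.new-ξ) (≡.sym N.new-η) new-edge-holds
      OnCurve-oneStep u v uv | inj₂ (inj₂ (refl , refl)) =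
        relabel (≡.sym (≡.trans (R.ξ-sym u v uv) N.new-ξ)) refl
          (ΦVanishes-sym A C γ d γᵈ≈1 (X Fin.zero) S.x d∣η′+e new-edge-holds)
        where
          d∣η′+e : d ∣ η G u v ℕ.+ S.e
          d∣η′+e = ≡.subst (λ h → d ∣ η G u v ℕ.+ h) N.new-η (R.η-sum u v uv)

    OnCurve-generates : ∀ {r} {G₀ G : Graph k} → Generates r k d G₀ G →
      OnCurve K A C γ d G₀ X → OnCurve K A C γ d G X
    OnCurve-generates = fold (λ G₀ G → OnCurve K A C γ d G₀ X → OnCurve K A C γ d G X)
      (λ step onRest → onRest ∘ OnCurve-oneStep step) id

lemma2p20 : ∀ {c ℓ} (p d : ℕ) (a₀ c₀ g₀ : ℕ) (k : ℕ) (r : ℤ) →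
    Prime p → 2 ≤ d → d ∣ (p ∸ 1) → 1 ≤ k → -1ℤ Data.Integer.≤ r →
    (K : CommutativeRing c ℓ) → IsField K →
    let open CommutativeRing K
        open FieldOps K
        A = ι a₀
        C = ι c₀
        γ = ι g₀
    in ι p ≈ 0# →
       ¬ (A ≈ 0#) →
       γ ^ d ≈ 1# → (∀ j → 1 ≤ j → suc j ≤ d → ¬ (γ ^ j ≈ 1#)) →
       (G G₀ : Graph k) →
       IsRKD r k d G → Complete G → IsProper d G →
       IsTree r k d G₀ → Generates r k d G₀ G →
       (X : Fin (suc k) → Carrier) → ¬ (∀ i → X i ≈ 0#) →
       (OnCurve K A C γ d G X → OnCurve K A C γ d G₀ X)
         × (OnCurve K A C γ d G₀ X → OnCurve K A C γ d G X)
lemma2p20 _ d a₀ c₀ g₀ _ _ _ _ _ _ _ K _ _ _ γᵈ≈1 _ _ _ _ _ _ _ G₀⇒G X _ =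
    OnCurve-restrict A C γ d γᵈ≈1 X (Generates⇒Extends G₀⇒G)
  , OnCurve-generates A C γ d γᵈ≈1 X G₀⇒G
  where
    open Varieties K
    open FieldOps K using (ι)
    A = ι a₀
    C = ι c₀
    γ = ι g₀
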